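{- Let $G(X,Y)$ be a non-complete bipartite graph. Then $|Y|-\epsilon(X)=|X|-\epsilon(Y)$, and (i) for $A\subseteq X$: $A$ is a fragment in $X$ if and only if [$Y\setminus N(A)$ is a fragment in $Y$ and $N(Y\setminus N(A))=X\setminus A$]; (ii) if $A,B$ are fragments in $X$ with $A\cap B\ne\emptyset$ and $N(A\cup B)\ne Y$, then $A\cap B$ and $A\cup B$ are both fragments in $X$.
   Context: All graphs are finite and simple. A bipartite graph $G(X,Y)$ has vertex set the disjoint union of $X$ and $Y$, every edge joining a vertex of $X$ to a vertex of $Y$; it is complete if every vertex of $X$ is adjacent to every vertex of $Y$. $N(v)$ is the neighbourhood of a vertex $v$ and $N(A)=\bigcup_{v\in A}N(v)$. Define $\epsilon(X)=\min\{|N(A)|-|A| : \emptyset\ne A\subseteq X,\ N(A)\ne Y\}$ and $\epsilon(Y)=\min\{|N(B)|-|B| : \emptyset\ne B\subseteq Y,\ N(B)\ne X\}$. A fragment in $X$ is a nonempty $A\subseteq X$ with $N(A)\ne Y$ and $|N(A)|-|A|=\epsilon(X)$; fragments in $Y$ are defined symmetrically. -}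

module Defs where

open import Data.Bool using (Bool; true; false; _∧_; _∨_)
open import Data.Nat using (ℕ; zero; suc)
open import Data.Integer using (ℤ; +_; _-_; _⊓_)
open import Data.Fin using (Fin)
open import Data.Fin.Subset using (Subset; outside; inside; ⊤; ∣_∣; Nonempty)
open import Data.Vec using (Vec; []; _∷_; tabulate; lookup)
open import Data.List using (List; []; _∷_; _++_; map; foldr; filter)
open import Data.Product using (_×_; ∃₂)
open import Relation.Binary.PropositionalEquality using (_≡_; _≢_)
open import Relation.Nullary using (¬_; does)
open import Relation.Nullary.Decidable using (_×-dec_; ¬?)
open import Data.Fin.Subset.Properties using (nonempty?)
open import Data.Vec.Properties using (≡-dec)
import Data.Bool.Properties as BP

-- A bipartite graph G(X,Y) with X = Fin m, Y = Fin n is given by its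
-- adjacency relation  E : Fin m → Fin n → Bool  (E x y ≡ true iff xy is an edge).
-- All notions below are stated for one "side" R : Fin a → Fin b → Bool;
-- the X-side uses E, the Y-side uses the transpose (flip E).

anyF : {k : ℕ} → (Fin k → Bool) → Bool
anyF {zero}  p = false
anyF {suc k} p = p Fin.zero ∨ anyF (λ i → p (Fin.suc i))

N : {a b : ℕ} → (Fin a → Fin b → Bool) → Subset a → Subset b
N R A = tabulate (λ y → anyF (λ x → lookup A x ∧ R x y))

surplus : {a b : ℕ} → (Fin a → Fin b → Bool) → Subset a → ℤ
surplus R A = + ∣ N R A ∣ - + ∣ A ∣

allSubsets : (k : ℕ) → List (Subset k)
allSubsets zero    = [] ∷ []
allSubsets (suc k) = map (outside ∷_) (allSubsets k) ++ map (inside ∷_) (allSubsets k)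

admissible? : {a b : ℕ} → (Fin a → Fin b → Bool) → Subset a → Bool
admissible? R A = does (nonempty? A ×-dec ¬? (≡-dec BP._≟_ (N R A) ⊤))

minimumℤ : List ℤ → ℤ
minimumℤ []       = + 0   -- never used for non-complete graphs
minimumℤ (x ∷ xs) = foldr _⊓_ x xs

ε : {a b : ℕ} → (Fin a → Fin b → Bool) → ℤ
ε {a} R = minimumℤ (map (surplus R) (filter (λ A → BP.T? (admissible? R A)) (allSubsets a)))

Fragment : {a b : ℕ} → (Fin a → Fin b → Bool) → Subset a → Set
Fragment R A = Nonempty A × (N R A ≢ ⊤) × (surplus R A ≡ ε R)

NonComplete : {m n : ℕ} → (Fin m → Fin n → Bool) → Set
NonComplete E = ∃₂ λ x y → E x y ≡ false

module Submission where

open import Defs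
open import Data.Bool using (Bool)
open import Data.Nat using (ℕ)
open import Data.Integer using (+_; _-_)
open import Data.Fin using (Fin)
open import Data.Fin.Subset using (Subset; ∁; _∩_; _∪_; ⊤; Nonempty)
open import Data.Product using (_×_)
open import Function using (flip)
open import Function.Bundles using (_⇔_)
open import Relation.Binary.PropositionalEquality using (_≡_; _≢_)

open import Data.Bool using (true; false; _∧_; T)
import Data.Bool.Properties as Boolₚ
import Data.Nat as ℕ
import Data.Nat.Properties as ℕₚ
open import Data.Integer using (ℤ; _+_; -_; _≤_; +≤+; 0ℤ; _⊓_)
import Data.Integer.Properties as ℤₚ
open import Data.Integer.Tactic.RingSolver using (solve-∀)
import Algebra.Properties.AbelianGroup ℤₚ.+-0-abelianGroup as ℤ-group
open import Data.Fin.Subset using (_∈_; _⊆_; ∣_∣; ⁅_⁆; outside; inside)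
open import Data.Fin.Subset.Properties
open import Data.Vec using ([]; _∷_)
open import Data.Vec.Properties using (lookup∘tabulate; []=⇒lookup; lookup⇒[]=; ≡-dec)
open import Data.List using (_∷_; map; filter)
open import Data.List.Properties using (foldr-preservesᵇ; foldr-preservesᵒ)
open import Data.List.Membership.Propositional using () renaming (_∈_ to _∈ₗ_)
open import Data.List.Membership.Propositional.Properties
  using (∈-map⁺; ∈-map⁻; ∈-filter⁺; ∈-filter⁻; ∈-++⁺ˡ; ∈-++⁺ʳ)
open import Data.List.Relation.Unary.All using (tabulate)
open import Data.List.Relation.Unary.Any as Any using (Any; here; there)
open import Data.Product using (∃; _,_; proj₁; proj₂)
open import Data.Sum using (_⊎_; inj₁; inj₂; [_,_])
open import Function.Bundles using (mk⇔; Equivalence)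
open import Relation.Binary.PropositionalEquality using (refl; sym; trans; cong; cong₂; subst; module ≡-Reasoning)
open import Relation.Nullary using (Dec; yes; no; contradiction)
open import Relation.Nullary.Decidable using (_×-dec_; ¬?; toWitness; fromWitness; isYes≗does)

-- For one side R : Fin a → Fin b → Bool of the graph (R = E for X,
-- R' = flip R for Y) and A ⊆ Fin a, the set  B = ∁ N(A)  has no neighbour in
-- A, i.e. N'(B) ⊆ ∁ A.  Counting gives the dual surplus identity
--     surplus R' B + (|∁ A| ∸ |N'(B)|) = (a - b) + surplus R A,
-- so surplus R' B ≤ (a - b) + surplus R A, with equality iff N'(B) = ∁ A.
-- B is admissible (nonempty with N'(B) ≠ everything) whenever A is.  Applied
-- to a set attaining ε R this gives ε R' ≤ (a - b) + ε R; a non-edge makes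
-- singletons admissible on both sides, so by symmetry ε(Y) = (m - n) + ε(X),
-- which is the first claim.  Part (i) is exactly the equality case of the
-- inequality.  Part (ii) follows from submodularity of the surplus,
--     surplus(A ∪ B) + surplus(A ∩ B) ≤ surplus A + surplus B,
-- because both terms on the left are at least ε.

anyF⁻ : ∀ {k} (p : Fin k → Bool) → anyF p ≡ true → ∃ λ i → p i ≡ true
anyF⁻ {ℕ.zero}  p ()
anyF⁻ {ℕ.suc k} p h with p Fin.zero in eq
... | true  = Fin.zero , eq
... | false = let i , pi = anyF⁻ (λ i → p (Fin.suc i)) h in Fin.suc i , pi

anyF⁺ : ∀ {k} (p : Fin k → Bool) i → p i ≡ true → anyF p ≡ true
anyF⁺ p Fin.zero    pi rewrite pi = refl
anyF⁺ p (Fin.suc i) pi with p Fin.zero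
... | true  = refl
... | false = anyF⁺ (λ i → p (Fin.suc i)) i pi

∧-true : ∀ {x y} → x ∧ y ≡ true → x ≡ true × y ≡ true
∧-true {true} {true} _ = refl , refl

module Neighbourhood {a b : ℕ} (R : Fin a → Fin b → Bool) where

  ∈N⁻ : ∀ {A y} → y ∈ N R A → ∃ λ x → x ∈ A × R x y ≡ true
  ∈N⁻ {A} {y} y∈NA =
    let x , e = anyF⁻ _ (trans (sym (lookup∘tabulate _ y)) ([]=⇒lookup y∈NA))
        x∈A , Rxy = ∧-true e
    in x , lookup⇒[]= x A x∈A , Rxy

  ∈N⁺ : ∀ {A x y} → x ∈ A → R x y ≡ true → y ∈ N R A
  ∈N⁺ {A} {x} {y} x∈A Rxy = lookup⇒[]= y (N R A)
    (trans (lookup∘tabulate _ y) (anyF⁺ _ x (cong₂ _∧_ ([]=⇒lookup x∈A) Rxy)))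

  N-mono : ∀ {A B} → A ⊆ B → N R A ⊆ N R B
  N-mono A⊆B y∈NA = let x , x∈A , Rxy = ∈N⁻ y∈NA in ∈N⁺ (A⊆B x∈A) Rxy

  N-∪ : ∀ A B → N R (A ∪ B) ⊆ N R A ∪ N R B
  N-∪ A B y∈N with ∈N⁻ y∈N
  ... | x , x∈A∪B , Rxy with x∈p∪q⁻ A B x∈A∪B
  ...   | inj₁ x∈A = x∈p∪q⁺ (inj₁ (∈N⁺ x∈A Rxy))
  ...   | inj₂ x∈B = x∈p∪q⁺ (inj₂ (∈N⁺ x∈B Rxy))

  N-∩ : ∀ A B → N R (A ∩ B) ⊆ N R A ∩ N R B
  N-∩ A B y∈N =
    let x , x∈A∩B , Rxy = ∈N⁻ y∈N
        x∈A , x∈B = x∈p∩q⁻ A B x∈A∩B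
    in x∈p∩q⁺ (∈N⁺ x∈A Rxy , ∈N⁺ x∈B Rxy)

open Neighbourhood

N-dual-⊆ : ∀ {a b} (R : Fin a → Fin b → Bool) A → N (flip R) (∁ (N R A)) ⊆ ∁ A
N-dual-⊆ R A x∈N' =
  let y , y∉NA , Rxy = ∈N⁻ (flip R) x∈N'
  in x∉p⇒x∈∁p (λ x∈A → x∈∁p⇒x∉p y∉NA (∈N⁺ R x∈A Rxy))

∣p∪q∣+∣p∩q∣ : ∀ {k} (p q : Subset k) → ∣ p ∪ q ∣ ℕ.+ ∣ p ∩ q ∣ ≡ ∣ p ∣ ℕ.+ ∣ q ∣
∣p∪q∣+∣p∩q∣ []            []            = refl
∣p∪q∣+∣p∩q∣ (inside ∷ p)  (inside ∷ q)  =
  cong ℕ.suc (trans (ℕₚ.+-suc _ _) (trans (cong ℕ.suc (∣p∪q∣+∣p∩q∣ p q)) (sym (ℕₚ.+-suc _ _))))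
∣p∪q∣+∣p∩q∣ (inside ∷ p)  (outside ∷ q) = cong ℕ.suc (∣p∪q∣+∣p∩q∣ p q)
∣p∪q∣+∣p∩q∣ (outside ∷ p) (inside ∷ q)  = trans (cong ℕ.suc (∣p∪q∣+∣p∩q∣ p q)) (sym (ℕₚ.+-suc _ _))
∣p∪q∣+∣p∩q∣ (outside ∷ p) (outside ∷ q) = ∣p∪q∣+∣p∩q∣ p q

⊆-∣∣-≡ : ∀ {k} {p q : Subset k} → p ⊆ q → ∣ q ∣ ℕ.≤ ∣ p ∣ → p ≡ q
⊆-∣∣-≡ {p = p} {q} p⊆q ∣q∣≤∣p∣ = ⊆-antisym p⊆q q⊆p
  where
  q⊆p : q ⊆ p
  q⊆p {x} x∈q with x ∈? p
  ... | yes x∈p = x∈p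
  ... | no  x∉p = contradiction (p⊂q⇒∣p∣<∣q∣ (p⊆q , x , x∈q , x∉p)) (ℕₚ.≤⇒≯ ∣q∣≤∣p∣)

≢⊤⇒∁-nonempty : ∀ {k} {p : Subset k} → p ≢ ⊤ → Nonempty (∁ p)
≢⊤⇒∁-nonempty {p = p} p≢⊤ with nonempty? (∁ p)
... | yes ne = ne
... | no  ¬ne = contradiction (⊆-antisym ⊆⊤ (λ {x} _ → x∉∁p⇒x∈p (λ x∈∁p → ¬ne (x , x∈∁p)))) p≢⊤

∁-nonempty⇒≢⊤ : ∀ {k} {p : Subset k} → Nonempty (∁ p) → p ≢ ⊤
∁-nonempty⇒≢⊤ (x , x∈∁p) p≡⊤ = x∈∁p⇒x∉p x∈∁p (subst (x ∈_) (sym p≡⊤) ∈⊤)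

∁≢⊤⇒nonempty : ∀ {k} {p : Subset k} → ∁ p ≢ ⊤ → Nonempty p
∁≢⊤⇒nonempty ∁p≢⊤ =
  let x , x∈∁∁p = ≢⊤⇒∁-nonempty ∁p≢⊤ in x , x∉∁p⇒x∈p (x∈∁p⇒x∉p x∈∁∁p)

+-∸ : ∀ {j k} → j ℕ.≤ k → + (k ℕ.∸ j) ≡ + k - + j
+-∸ {j} {k} j≤k = trans (sym (ℤₚ.⊖-≥ j≤k)) (sym (ℤₚ.[+m]-[+n]≡m⊖n k j))

∣∁p∣ℤ : ∀ {k} (p : Subset k) → + ∣ ∁ p ∣ ≡ + k - + ∣ p ∣
∣∁p∣ℤ p = trans (cong +_ (∣∁p∣≡n∸∣p∣ p)) (+-∸ (∣p∣≤n p))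

Admissible : ∀ {a b} → (Fin a → Fin b → Bool) → Subset a → Set
Admissible R A = Nonempty A × N R A ≢ ⊤

∈-allSubsets : ∀ {k} (A : Subset k) → A ∈ₗ allSubsets k
∈-allSubsets {ℕ.zero}  []            = here refl
∈-allSubsets {ℕ.suc k} (outside ∷ A) = ∈-++⁺ˡ (∈-map⁺ (outside ∷_) (∈-allSubsets A))
∈-allSubsets {ℕ.suc k} (inside ∷ A)  =
  ∈-++⁺ʳ (map (outside ∷_) (allSubsets k)) (∈-map⁺ (inside ∷_) (∈-allSubsets A))

minimumℤ-≤ : ∀ {xs y} → y ∈ₗ xs → minimumℤ xs ≤ y
minimumℤ-≤ {x ∷ xs} {y} y∈ = foldr-preservesᵒ {P = _≤ y} bound x xs (first-or-rest y∈)
  where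
  bound : ∀ u v → u ≤ y ⊎ v ≤ y → u ⊓ v ≤ y
  bound u v = [ ℤₚ.i≤j⇒i⊓k≤j v , ℤₚ.i≤j⇒k⊓i≤j u ]
  first-or-rest : y ∈ₗ x ∷ xs → x ≤ y ⊎ Any (_≤ y) xs
  first-or-rest (here y≡x)    = inj₁ (ℤₚ.≤-reflexive (sym y≡x))
  first-or-rest (there y∈xs) = inj₂ (Any.map (λ y≡z → ℤₚ.≤-reflexive (sym y≡z)) y∈xs)

minimumℤ-∈ : ∀ {xs y} → y ∈ₗ xs → minimumℤ xs ∈ₗ xs
minimumℤ-∈ {x ∷ xs} _ = foldr-preservesᵇ {P = _∈ₗ x ∷ xs} select (here refl) (tabulate there)
  where
  select : ∀ {u v} → u ∈ₗ x ∷ xs → v ∈ₗ x ∷ xs → u ⊓ v ∈ₗ x ∷ xs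
  select {u} {v} u∈ v∈ with ℤₚ.⊓-sel u v
  ... | inj₁ u⊓v≡u = subst (_∈ₗ x ∷ xs) (sym u⊓v≡u) u∈
  ... | inj₂ u⊓v≡v = subst (_∈ₗ x ∷ xs) (sym u⊓v≡v) v∈

module _ {a b : ℕ} (R : Fin a → Fin b → Bool) where

  private
    admissible-dec : ∀ A → Dec (Admissible R A)
    admissible-dec A = nonempty? A ×-dec ¬? (≡-dec Boolₚ._≟_ (N R A) ⊤)

    surplus∈ : ∀ {A} → Admissible R A →
      surplus R A ∈ₗ map (surplus R) (filter (λ A → Boolₚ.T? (admissible? R A)) (allSubsets a))
    surplus∈ {A} adm = ∈-map⁺ (surplus R) (∈-filter⁺ (λ A → Boolₚ.T? (admissible? R A))
      (∈-allSubsets A) (subst T (isYes≗does (admissible-dec A)) (fromWitness adm)))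

  ε-minimal : ∀ {A} → Admissible R A → ε R ≤ surplus R A
  ε-minimal adm = minimumℤ-≤ (surplus∈ adm)

  ε-attained : ∀ {A} → Admissible R A → ∃ λ A₀ → Admissible R A₀ × surplus R A₀ ≡ ε R
  ε-attained adm =
    let A₀ , A₀∈ , ε≡ = ∈-map⁻ (surplus R) (minimumℤ-∈ (surplus∈ adm))
        _ , A₀-adm = ∈-filter⁻ (λ A → Boolₚ.T? (admissible? R A)) {xs = allSubsets a} A₀∈
    in A₀ , toWitness (subst T (sym (isYes≗does (admissible-dec A₀))) A₀-adm) , sym ε≡

⊆-≢⊤ : ∀ {k} {p q : Subset k} → p ⊆ q → q ≢ ⊤ → p ≢ ⊤
⊆-≢⊤ p⊆q q≢⊤ p≡⊤ = q≢⊤ (⊆-antisym ⊆⊤ (λ {x} _ → p⊆q (subst (x ∈_) (sym p≡⊤) ∈⊤)))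

non-edge⇒admissible : ∀ {a b} (R : Fin a → Fin b → Bool) {x y} → R x y ≡ false → Admissible R ⁅ x ⁆
non-edge⇒admissible R {x} {y} Rxy≡false = (x , x∈⁅x⁆ x) , y-missed
  where
  y-missed : N R ⁅ x ⁆ ≢ ⊤
  y-missed N≡⊤ with ∈N⁻ R (subst (y ∈_) (sym N≡⊤) ∈⊤)
  ... | x′ , x′∈⁅x⁆ , Rx′y with x∈⁅y⁆⇒x≡y x x′∈⁅x⁆
  ...   | refl = contradiction (trans (sym Rx′y) Rxy≡false) λ ()

-- The dual set ∁ N(A) on the other side.  Its surplus is bounded by that of
-- A shifted by a - b; the defect is slack A = |∁ A| ∸ |N'(∁ N(A))|, which
-- vanishes exactly when N'(∁ N(A)) = ∁ A.
module Duality {a b : ℕ} (R : Fin a → Fin b → Bool) where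

  slack : Subset a → ℕ
  slack A = ∣ ∁ A ∣ ℕ.∸ ∣ N (flip R) (∁ (N R A)) ∣

  dual-surplus : ∀ A → surplus (flip R) (∁ (N R A)) + + slack A ≡ (+ a - + b) + surplus R A
  dual-surplus A = begin
    (+ k - + ∣ ∁ (N R A) ∣) + + (∣ ∁ A ∣ ℕ.∸ k)
      ≡⟨ cong₂ (λ u v → (+ k - u) + v) (∣∁p∣ℤ (N R A)) (+-∸ (p⊆q⇒∣p∣≤∣q∣ (N-dual-⊆ R A))) ⟩
    (+ k - (+ b - + ∣ N R A ∣)) + (+ ∣ ∁ A ∣ - + k)
      ≡⟨ cong (λ u → (+ k - (+ b - + ∣ N R A ∣)) + (u - + k)) (∣∁p∣ℤ A) ⟩
    (+ k - (+ b - + ∣ N R A ∣)) + ((+ a - + ∣ A ∣) - + k)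
      ≡⟨ regroup (+ k) (+ b) (+ ∣ N R A ∣) (+ a) (+ ∣ A ∣) ⟩
    (+ a - + b) + (+ ∣ N R A ∣ - + ∣ A ∣) ∎
    where
    open ≡-Reasoning
    k = ∣ N (flip R) (∁ (N R A)) ∣
    regroup : ∀ (k b nA a cA : ℤ) → (k - (b - nA)) + ((a - cA) - k) ≡ (a - b) + (nA - cA)
    regroup = solve-∀

  dual-surplus-≤ : ∀ A → surplus (flip R) (∁ (N R A)) ≤ (+ a - + b) + surplus R A
  dual-surplus-≤ A = ℤₚ.≤-trans (ℤₚ.i≤i+j _ (+ slack A)) (ℤₚ.≤-reflexive (dual-surplus A))

  dual-tight : ∀ A → surplus (flip R) (∁ (N R A)) ≡ (+ a - + b) + surplus R A
                   ⇔ N (flip R) (∁ (N R A)) ≡ ∁ A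
  dual-tight A = mk⇔ to from
    where
    dual-s bound : ℤ
    dual-s = surplus (flip R) (∁ (N R A))
    bound  = (+ a - + b) + surplus R A
    to : dual-s ≡ bound → N (flip R) (∁ (N R A)) ≡ ∁ A
    to tight = ⊆-∣∣-≡ (N-dual-⊆ R A) (ℕₚ.m∸n≡0⇒m≤n (ℤₚ.+-injective slack≡0))
      where
      slack≡0 : + slack A ≡ 0ℤ
      slack≡0 = ℤ-group.∙-cancelˡ dual-s (+ slack A) 0ℤ
        (trans (dual-surplus A) (trans (sym tight) (sym (ℤₚ.+-identityʳ dual-s))))
    from : N (flip R) (∁ (N R A)) ≡ ∁ A → dual-s ≡ bound
    from N′≡∁A = trans (sym (ℤₚ.+-identityʳ dual-s))
      (trans (cong (λ s → dual-s + + s) (sym slack≡0)) (dual-surplus A))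
      where
      slack≡0 : slack A ≡ 0
      slack≡0 = trans (cong (λ B → ∣ ∁ A ∣ ℕ.∸ ∣ B ∣) N′≡∁A) (ℕₚ.n∸n≡0 ∣ ∁ A ∣)

  dual-admissible : ∀ {A} → Admissible R A → Admissible (flip R) (∁ (N R A))
  dual-admissible {A} ((x , x∈A) , NA≢⊤) = ≢⊤⇒∁-nonempty NA≢⊤ , x-missed
    where
    x-missed : N (flip R) (∁ (N R A)) ≢ ⊤
    x-missed N′≡⊤ = x∈∁p⇒x∉p (N-dual-⊆ R A (subst (x ∈_) (sym N′≡⊤) ∈⊤)) x∈A

  ε-dual-bound : ∀ {A} → Admissible R A → ε (flip R) ≤ (+ a - + b) + ε R
  ε-dual-bound adm =
    let A₀ , adm₀ , sA₀≡ε = ε-attained R adm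
    in ℤₚ.≤-trans (ε-minimal (flip R) (dual-admissible adm₀))
         (ℤₚ.≤-trans (dual-surplus-≤ A₀) (ℤₚ.≤-reflexive (cong (λ s → (+ a - + b) + s) sA₀≡ε)))

open Duality

-- Submodularity of the surplus, from |N(A ∪ B)| + |N(A ∩ B)| ≤ |N A| + |N B|
-- and inclusion–exclusion for A, B.
surplus-submodular : ∀ {a b} (R : Fin a → Fin b → Bool) A B →
  surplus R (A ∪ B) + surplus R (A ∩ B) ≤ surplus R A + surplus R B
surplus-submodular R A B = begin
  surplus R (A ∪ B) + surplus R (A ∩ B)
    ≡⟨ difference-sum (∣ N R (A ∪ B) ∣) (∣ A ∪ B ∣) (∣ N R (A ∩ B) ∣) (∣ A ∩ B ∣) ⟩
  + (∣ N R (A ∪ B) ∣ ℕ.+ ∣ N R (A ∩ B) ∣) - + (∣ A ∪ B ∣ ℕ.+ ∣ A ∩ B ∣)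
    ≡⟨ cong (λ s → + (∣ N R (A ∪ B) ∣ ℕ.+ ∣ N R (A ∩ B) ∣) - + s) (∣p∪q∣+∣p∩q∣ A B) ⟩
  + (∣ N R (A ∪ B) ∣ ℕ.+ ∣ N R (A ∩ B) ∣) - + (∣ A ∣ ℕ.+ ∣ B ∣)
    ≤⟨ ℤₚ.+-monoˡ-≤ (- + (∣ A ∣ ℕ.+ ∣ B ∣)) (+≤+ neighbours-≤) ⟩
  + (∣ N R A ∣ ℕ.+ ∣ N R B ∣) - + (∣ A ∣ ℕ.+ ∣ B ∣)
    ≡⟨ difference-sum (∣ N R A ∣) (∣ A ∣) (∣ N R B ∣) (∣ B ∣) ⟨
  surplus R A + surplus R B ∎
  where
  open ℤₚ.≤-Reasoning
  difference-sum : ∀ x y z w → (+ x - + y) + (+ z - + w) ≡ + (x ℕ.+ z) - + (y ℕ.+ w)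
  difference-sum x y z w = trans (regroup (+ x) (+ y) (+ z) (+ w))
    (sym (cong₂ _-_ (ℤₚ.pos-+ x z) (ℤₚ.pos-+ y w)))
    where
    regroup : ∀ (x y z w : ℤ) → (x - y) + (z - w) ≡ (x + z) - (y + w)
    regroup = solve-∀
  neighbours-≤ : ∣ N R (A ∪ B) ∣ ℕ.+ ∣ N R (A ∩ B) ∣ ℕ.≤ ∣ N R A ∣ ℕ.+ ∣ N R B ∣
  neighbours-≤ = ℕₚ.≤-trans
    (ℕₚ.+-mono-≤ (p⊆q⇒∣p∣≤∣q∣ (N-∪ R A B)) (p⊆q⇒∣p∣≤∣q∣ (N-∩ R A B)))
    (ℕₚ.≤-reflexive (∣p∪q∣+∣p∩q∣ (N R A) (N R B)))

both-minimal : ∀ {x y e : ℤ} → x + y ≤ e + e → e ≤ x → e ≤ y → x ≡ e × y ≡ e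
both-minimal {x} {y} {e} sum≤ e≤x e≤y =
  ℤₚ.≤-antisym (≤-of-sum sum≤ e≤y) e≤x ,
  ℤₚ.≤-antisym (≤-of-sum (ℤₚ.≤-trans (ℤₚ.≤-reflexive (ℤₚ.+-comm y x)) sum≤) e≤x) e≤y
  where
  ≤-of-sum : ∀ {u v} → u + v ≤ e + e → e ≤ v → u ≤ e
  ≤-of-sum {u} {v} uv≤ e≤v = begin
    u             ≡⟨ add-sub u v ⟩
    (u + v) - v   ≤⟨ ℤₚ.+-mono-≤ uv≤ (ℤₚ.neg-mono-≤ e≤v) ⟩
    (e + e) - e   ≡⟨ add-sub e e ⟨
    e             ∎
    where
    open ℤₚ.≤-Reasoning
    add-sub : ∀ (i j : ℤ) → i ≡ (i + j) - j
    add-sub = solve-∀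

shift-antisym : ∀ {x y} (p q : ℤ) → y ≤ (p - q) + x → x ≤ (q - p) + y → y ≡ (p - q) + x
shift-antisym {x} {y} p q y≤ x≤ = ℤₚ.≤-antisym y≤ (begin
  (p - q) + x               ≤⟨ ℤₚ.+-monoʳ-≤ (p - q) x≤ ⟩
  (p - q) + ((q - p) + y)   ≡⟨ shifts-cancel p q y ⟩
  y                         ∎)
  where
  open ℤₚ.≤-Reasoning
  shifts-cancel : ∀ (p q y : ℤ) → (p - q) + ((q - p) + y) ≡ y
  shifts-cancel = solve-∀

-- In a non-complete graph ε(Y) = (|X| - |Y|) + ε(X): the dual bound applies on
-- both sides, the admissible sets being provided by a non-edge.
ε-duality : ∀ {m n : ℕ} (E : Fin m → Fin n → Bool) → NonComplete E → ε (flip E) ≡ (+ m - + n) + ε E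
ε-duality {m} {n} E (x , y , Exy≡false) = shift-antisym (+ m) (+ n)
  (ε-dual-bound E (non-edge⇒admissible E Exy≡false))
  (ε-dual-bound (flip E) (non-edge⇒admissible (flip E) Exy≡false))

fragment-dual : ∀ {a b} (R : Fin a → Fin b → Bool) → ε (flip R) ≡ (+ a - + b) + ε R →
  ∀ A → Fragment R A ⇔ (Fragment (flip R) (∁ (N R A)) × (N (flip R) (∁ (N R A)) ≡ ∁ A))
fragment-dual {a} {b} R ε′≡ A = mk⇔ to from
  where
  shift : ℤ → ℤ
  shift s = (+ a - + b) + s
  to : Fragment R A → Fragment (flip R) (∁ (N R A)) × (N (flip R) (∁ (N R A)) ≡ ∁ A)
  to (ne , NA≢⊤ , sA≡ε) = (proj₁ adm′ , proj₂ adm′ , trans tight (trans (cong shift sA≡ε) (sym ε′≡))) ,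
                          Equivalence.to (dual-tight R A) tight
    where
    adm′ : Admissible (flip R) (∁ (N R A))
    adm′ = dual-admissible R (ne , NA≢⊤)
    tight : surplus (flip R) (∁ (N R A)) ≡ shift (surplus R A)
    tight = ℤₚ.≤-antisym (dual-surplus-≤ R A) (begin
      shift (surplus R A)            ≡⟨ cong shift sA≡ε ⟩
      shift (ε R)                    ≡⟨ ε′≡ ⟨
      ε (flip R)                     ≤⟨ ε-minimal (flip R) adm′ ⟩
      surplus (flip R) (∁ (N R A))   ∎)
      where open ℤₚ.≤-Reasoning
  from : Fragment (flip R) (∁ (N R A)) × (N (flip R) (∁ (N R A)) ≡ ∁ A) → Fragment R A
  from ((ne′ , N′≢⊤ , s′≡ε′) , N′≡∁A) =
    ∁≢⊤⇒nonempty (subst (_≢ ⊤) N′≡∁A N′≢⊤) , ∁-nonempty⇒≢⊤ ne′ ,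
    ℤ-group.∙-cancelˡ (+ a - + b) (surplus R A) (ε R)
      (trans (sym (Equivalence.from (dual-tight R A) N′≡∁A)) (trans s′≡ε′ ε′≡))

fragment-lattice : ∀ {a b} (R : Fin a → Fin b → Bool) (A B : Subset a) →
  Fragment R A → Fragment R B → Nonempty (A ∩ B) → N R (A ∪ B) ≢ ⊤ →
  Fragment R (A ∩ B) × Fragment R (A ∪ B)
fragment-lattice R A B ((x , x∈A) , NA≢⊤ , sA≡ε) (_ , _ , sB≡ε) ne∩ N∪≢⊤ =
  (ne∩ , N∩≢⊤ , proj₂ both) , (ne∪ , N∪≢⊤ , proj₁ both)
  where
  N∩≢⊤ : N R (A ∩ B) ≢ ⊤
  N∩≢⊤ = ⊆-≢⊤ (N-mono R (p∩q⊆p A B)) NA≢⊤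
  ne∪ : Nonempty (A ∪ B)
  ne∪ = x , p⊆p∪q B x∈A
  both : surplus R (A ∪ B) ≡ ε R × surplus R (A ∩ B) ≡ ε R
  both = both-minimal
    (ℤₚ.≤-trans (surplus-submodular R A B) (ℤₚ.≤-reflexive (cong₂ _+_ sA≡ε sB≡ε)))
    (ε-minimal R (ne∪ , N∪≢⊤))
    (ε-minimal R (ne∩ , N∩≢⊤))

lemma2p1 : (m n : ℕ) (E : Fin m → Fin n → Bool) → NonComplete E →
    ((+ n - ε E) ≡ (+ m - ε (flip E)))
    × (∀ (A : Subset m) → Fragment E A ⇔ (Fragment (flip E) (∁ (N E A)) × (N (flip E) (∁ (N E A)) ≡ ∁ A)))
    × (∀ (A B : Subset m) → Fragment E A → Fragment E B → Nonempty (A ∩ B) → N E (A ∪ B) ≢ ⊤ →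
    Fragment E (A ∩ B) × Fragment E (A ∪ B))
lemma2p1 m n E nc = sizes-minus-ε , fragment-dual E εY≡ , fragment-lattice E
  where
  εY≡ : ε (flip E) ≡ (+ m - + n) + ε E
  εY≡ = ε-duality E nc
  sizes-minus-ε : + n - ε E ≡ + m - ε (flip E)
  sizes-minus-ε = sym (trans (cong (λ e → + m - e) εY≡) (unshift (+ m) (+ n) (ε E)))
    where
    unshift : ∀ (p q e : ℤ) → p - ((p - q) + e) ≡ q - e
    unshift = solve-∀
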